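{- Let $m,n\ge 1$ and consider the complete bipartite graph $K_{m,n}$, properly two-colored (one part one color, the other part the other color). The \textsc{flag coloring} position on $K_{m,n}$ is a $\mathcal{P}$-position if and only if $m\ge 2$ and $n\ge 2$.
   Context: \textsc{flag coloring} is an impartial two-player game played on a simple graph whose vertices are colored. A move consists of choosing a vertex $v$, of color $c$ say, and a color $c'\neq c$ that is the color of some vertex adjacent to $v$; then $v$ and every vertex of the connected component of the subgraph induced by color-$c$ vertices that contains $v$ are recolored $c'$. Play is under the normal play convention: a player unable to move loses. A position is a $\mathcal{P}$-position if the player to move has no winning strategy (equivalently, its Sprague–Grundy value is $0$), and an $\mathcal{N}$-position otherwise. -}

module Defs where

open import Data.Nat using (ℕ)
open import Data.Fin using (Fin)
open import Data.Sum using (_⊎_; inj₁; inj₂)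
open import Data.Product using (_×_; ∃-syntax)
open import Data.Unit using (⊤)
open import Data.Empty using (⊥)
open import Relation.Nullary using (¬_)
open import Relation.Binary.PropositionalEquality using (_≡_; _≢_)
open import Relation.Binary.Construct.Closure.ReflexiveTransitive using (Star)

module FlagColoring {V : Set} (E : V → V → Set) where

  Coloring : Set
  Coloring = V → ℕ

  InducedEdge : Coloring → ℕ → V → V → Set
  InducedEdge col c x y = E x y × col x ≡ c × col y ≡ c

  SameComp : Coloring → V → V → Set
  SameComp col v w = Star (InducedEdge col (col v)) v w

  Move : Coloring → Coloring → Set
  Move col col' =
    ∃[ v ] ∃[ u ] ∃[ c' ]
      (E v u × col u ≡ c' × c' ≢ col v ×
       (∀ w → (SameComp col v w → col' w ≡ c') × (¬ SameComp col v w → col' w ≡ col w)))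

  -- P-positions (player to move loses) and N-positions, normal play, defined
  -- inductively along the (finite) game tree.
  mutual
    data IsP (col : Coloring) : Set where
      isP : (∀ col' → Move col col' → IsN col') → IsP col

    data IsN (col : Coloring) : Set where
      isN : ∀ col' → Move col col' → IsP col' → IsN col

KEdge : ∀ {m n} → (Fin m ⊎ Fin n) → (Fin m ⊎ Fin n) → Set
KEdge (inj₁ _) (inj₁ _) = ⊥
KEdge (inj₁ _) (inj₂ _) = ⊤
KEdge (inj₂ _) (inj₁ _) = ⊤
KEdge (inj₂ _) (inj₂ _) = ⊥

KColoring : ∀ {m n} → (Fin m ⊎ Fin n) → ℕ
KColoring (inj₁ _) = 0
KColoring (inj₂ _) = 1

{-# OPTIONS --safe #-}
module Submission where

-- In the proper 2-coloring of K_{m,n} every monochromatic component is a single vertex,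
-- so a move recolors one vertex v to the color of the opposite side. If m, n ≥ 2 the
-- answer is forced: the opposite side together with v is now one component, and
-- recoloring it with the color of v's old side (still present, as that side has another
-- vertex) makes the graph monochromatic, so the second player wins. If one side is a
-- single vertex, recoloring that vertex makes the graph monochromatic at once.

open import Defs
open import Data.Nat using (ℕ; _≤_; zero; suc; s≤s; z≤n)
open import Data.Nat.Properties using () renaming (_≟_ to _≟ℕ_)
open import Data.Fin using (Fin; _≟_)
open import Data.Sum using (_⊎_; inj₁; inj₂)
open import Data.Sum.Properties using (≡-dec; inj₁-injective; inj₂-injective)
open import Data.Product using (_×_; _,_; proj₁; proj₂; ∃-syntax; uncurry)
open import Data.Empty using (⊥-elim)
open import Function using (_∘_)
open import Function.Bundles using (_⇔_; mk⇔)
open import Relation.Nullary using (¬_; yes; no; contradiction)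
open import Relation.Binary.PropositionalEquality using (_≡_; _≢_; refl; sym; trans)
open import Relation.Binary.Construct.Closure.ReflexiveTransitive using (ε; _◅_)

module FlagColoringFacts {V : Set} (E : V → V → Set) where
  open FlagColoring E public

  P⇒¬N : ∀ {col} → IsP col → ¬ IsN col
  P⇒¬N (isP next) (isN col' move p) = P⇒¬N p (next col' move)

  constant-isP : ∀ c → IsP (λ _ → c)
  constant-isP c = isP λ { _ (_ , _ , _ , _ , col-u≡c' , c'≢c , _) → contradiction (sym col-u≡c') c'≢c }

  flood-isN : ∀ {col v u c} → E v u → col u ≡ c → c ≢ col v →
              (∀ w → ¬ SameComp col v w → col w ≡ c) → IsN col
  flood-isN {v = v} {u} {c} v~u col-u≡c c≢col-v outside =
    isN (λ _ → c) (v , u , c , v~u , col-u≡c , c≢col-v , λ w → (λ _ → refl) , sym ∘ outside w)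
        (constant-isP c)

  proper⇒SameComp-≡ : ∀ {col} → (∀ {x y} → E x y → col x ≢ col y) →
                      ∀ {v w} → SameComp col v w → v ≡ w
  proper⇒SameComp-≡ proper ε = refl
  proper⇒SameComp-≡ proper ((x~y , _ , col-y≡col-x) ◅ _) = contradiction (sym col-y≡col-x) (proper x~y)

Fin-other : ∀ {k} → 2 ≤ k → (i : Fin k) → ∃[ j ] j ≢ i
Fin-other (s≤s (s≤s _)) Fin.zero    = Fin.suc Fin.zero , λ ()
Fin-other (s≤s (s≤s _)) (Fin.suc _) = Fin.zero , λ ()

module CompleteBipartite (m n : ℕ) where
  open FlagColoringFacts (KEdge {m} {n}) public

  V : Set
  V = Fin m ⊎ Fin n

  κ : Coloring
  κ = KColoring

  KEdge-proper : ∀ {x y : V} → KEdge x y → κ x ≢ κ y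
  KEdge-proper {inj₁ _} {inj₂ _} _ ()
  KEdge-proper {inj₂ _} {inj₁ _} _ ()

  KEdge-complete : ∀ {x y : V} → κ x ≢ κ y → KEdge x y
  KEdge-complete {inj₁ _} {inj₁ _} κx≢κy = contradiction refl κx≢κy
  KEdge-complete {inj₁ _} {inj₂ _} _     = _
  KEdge-complete {inj₂ _} {inj₁ _} _     = _
  KEdge-complete {inj₂ _} {inj₂ _} κx≢κy = contradiction refl κx≢κy

  κ-two-valued : ∀ {x y z : V} → κ x ≢ κ y → κ y ≢ κ z → κ x ≡ κ z
  κ-two-valued {inj₁ _} {inj₂ _} {inj₁ _} _ _ = refl
  κ-two-valued {inj₂ _} {inj₁ _} {inj₂ _} _ _ = refl
  κ-two-valued {inj₁ _} {inj₁ _} κx≢κy _     = contradiction refl κx≢κy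
  κ-two-valued {inj₂ _} {inj₂ _} κx≢κy _     = contradiction refl κx≢κy
  κ-two-valued {_} {inj₁ _} {inj₁ _} _ κy≢κz = contradiction refl κy≢κz
  κ-two-valued {_} {inj₂ _} {inj₂ _} _ κy≢κz = contradiction refl κy≢κz

  same-side-other : 2 ≤ m → 2 ≤ n → (v : V) → ∃[ k ] k ≢ v × κ k ≡ κ v
  same-side-other 2≤m _ (inj₁ i) with Fin-other 2≤m i
  ... | j , j≢i = inj₁ j , j≢i ∘ inj₁-injective , refl
  same-side-other _ 2≤n (inj₂ i) with Fin-other 2≤n i
  ... | j , j≢i = inj₂ j , j≢i ∘ inj₂-injective , refl

  singleton-side-isN : (v u : V) → κ u ≢ κ v → (∀ w → κ w ≡ κ v → w ≡ v) → IsN κ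
  singleton-side-isN v u κu≢κv alone = flood-isN (KEdge-complete (κu≢κv ∘ sym)) refl κu≢κv outside
    where
    outside : ∀ w → ¬ SameComp κ v w → κ w ≡ κ u
    outside w w∉ with κ w ≟ℕ κ v
    ... | no κw≢κv = κ-two-valued κw≢κv (κu≢κv ∘ sym)
    ... | yes κw≡κv with alone w κw≡κv
    ...   | refl = contradiction ε w∉

  recolored-isN : 2 ≤ m → 2 ≤ n → ∀ {col' v u} → κ u ≢ κ v → col' v ≡ κ u →
                  (∀ w → w ≢ v → col' w ≡ κ w) → IsN col'
  recolored-isN 2≤m 2≤n {col'} {v} {u} κu≢κv col'-v col'-unchanged
    with same-side-other 2≤m 2≤n v
  ... | k , k≢v , κk≡κv =
    flood-isN (KEdge-complete κu≢κk) (trans (col'-unchanged k k≢v) κk≡κv) κv≢col'-u outside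
    where
    col'-u : col' u ≡ κ u
    col'-u = col'-unchanged u λ { refl → κu≢κv refl }

    κu≢κk : κ u ≢ κ k
    κu≢κk κu≡κk = κu≢κv (trans κu≡κk κk≡κv)

    κv≢col'-u : κ v ≢ col' u
    κv≢col'-u κv≡col'-u = κu≢κv (sym (trans κv≡col'-u col'-u))

    col'-v≡col'-u : col' v ≡ col' u
    col'-v≡col'-u = trans col'-v (sym col'-u)

    u→v : InducedEdge col' (col' u) u v
    u→v = KEdge-complete κu≢κv , refl , col'-v≡col'-u

    outside : ∀ w → ¬ SameComp col' u w → col' w ≡ κ v
    outside w w∉ with ≡-dec _≟_ _≟_ w v
    ... | yes refl = contradiction (u→v ◅ ε) w∉
    ... | no w≢v with κ w ≟ℕ κ u
    ...   | no κw≢κu  = trans (col'-unchanged w w≢v) (κ-two-valued κw≢κu κu≢κv)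
    ...   | yes κw≡κu = contradiction (u→v ◅ v→w ◅ ε) w∉
      where
      v→w : InducedEdge col' (col' u) v w
      v→w = KEdge-complete (λ κv≡κw → κu≢κv (sym (trans κv≡κw κw≡κu))) ,
            col'-v≡col'-u ,
            trans (col'-unchanged w w≢v) (trans κw≡κu (sym col'-u))

  κ-isP : 2 ≤ m → 2 ≤ n → IsP κ
  κ-isP 2≤m 2≤n = isP λ { col' (v , u , _ , _ , refl , κu≢κv , recolor) →
    recolored-isN 2≤m 2≤n κu≢κv (proj₁ (recolor v) ε)
      (λ w w≢v → proj₂ (recolor w) (w≢v ∘ sym ∘ proper⇒SameComp-≡ KEdge-proper)) }

κ-isP⇒2≤ : ∀ m n → 1 ≤ m → 1 ≤ n → CompleteBipartite.IsP m n (CompleteBipartite.κ m n) → 2 ≤ m × 2 ≤ n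
κ-isP⇒2≤ (suc zero) (suc n) _ _ p =
  ⊥-elim (P⇒¬N p (singleton-side-isN (inj₁ Fin.zero) (inj₂ Fin.zero) (λ ())
                              λ { (inj₁ Fin.zero) _ → refl ; (inj₂ _) () }))
  where open CompleteBipartite 1 (suc n)
κ-isP⇒2≤ (suc (suc m)) (suc zero) _ _ p =
  ⊥-elim (P⇒¬N p (singleton-side-isN (inj₂ Fin.zero) (inj₁ Fin.zero) (λ ())
                              λ { (inj₂ Fin.zero) _ → refl ; (inj₁ _) () }))
  where open CompleteBipartite (suc (suc m)) 1
κ-isP⇒2≤ (suc (suc m)) (suc (suc n)) _ _ _ = s≤s (s≤s z≤n) , s≤s (s≤s z≤n)

theorem5 : (m n : ℕ) → 1 ≤ m → 1 ≤ n →
    FlagColoring.IsP (KEdge {m} {n}) (KColoring {m} {n}) ⇔ (2 ≤ m × 2 ≤ n)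
theorem5 m n 1≤m 1≤n = mk⇔ (κ-isP⇒2≤ m n 1≤m 1≤n) (uncurry (CompleteBipartite.κ-isP m n))
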